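{- Let $G=(V,E)$ be a finite, simple, undirected graph, and for $v\in V$ let $N(v)$ denote the open neighborhood of $v$. Let $Q'$ be the integer program \[ \min\ 2\sum_{v\in V} q_v + \sum_{v\in V} r_v\quad\text{s.t. for all } v\in V:\ q_v+\tfrac12\sum_{u\in N(v)} q_u+\tfrac12\sum_{u\in N(v)} r_u\ \ge 1,\ \ r_v\le q_v,\ \ q_v,r_v\in\{0,1\}, \] and let $Q''$ be the mixed integer program with the same objective and the same first two families of constraints, but with variable domains $q_v\in\{0,1\}$ and $r_v\in[0,+\infty)$ for all $v\in V$. Then the optimal objective values of $Q'$ and $Q''$ are equal.
   Formalization: In $Q''$ the variables $r_v$ take nonnegative rational values instead of values in $[0,+\infty)$. -}

module Defs where

open import Data.Nat using (ℕ; zero; suc)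
open import Data.Fin using (Fin; zero; suc)
open import Data.Bool using (Bool; true; false; if_then_else_)
open import Data.Rational using (ℚ; 0ℚ; 1ℚ; ½; _+_; _*_; _≤_)
open import Data.Product using (Σ; _×_; _,_)
open import Relation.Binary.PropositionalEquality using (_≡_)

record SimpleGraph (n : ℕ) : Set where
  field
    adj    : Fin n → Fin n → Bool
    sym    : ∀ u v → adj u v ≡ adj v u
    irrefl : ∀ v → adj v v ≡ false
open SimpleGraph public

sumV : (n : ℕ) → (Fin n → ℚ) → ℚ
sumV zero    f = 0ℚ
sumV (suc n) f = f zero + sumV n (λ i → f (suc i))

sumN : ∀ {n} → SimpleGraph n → Fin n → (Fin n → ℚ) → ℚ
sumN {n} G v x = sumV n (λ u → if adj G v u then x u else 0ℚ)

b2q : Bool → ℚ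
b2q true  = 1ℚ
b2q false = 0ℚ

objective : ∀ {n} → (Fin n → ℚ) → (Fin n → ℚ) → ℚ
objective {n} q r = (1ℚ + 1ℚ) * sumV n q + sumV n r

Constraints : ∀ {n} → SimpleGraph n → (Fin n → ℚ) → (Fin n → ℚ) → Set
Constraints G q r =
  ∀ v → (1ℚ ≤ q v + ½ * sumN G v q + ½ * sumN G v r) × (r v ≤ q v)

FeasibleQ' : ∀ {n} → SimpleGraph n → (Fin n → Bool) → (Fin n → Bool) → Set
FeasibleQ' G q r = Constraints G (λ v → b2q (q v)) (λ v → b2q (r v))

FeasibleQ'' : ∀ {n} → SimpleGraph n → (Fin n → Bool) → (Fin n → ℚ) → Set
FeasibleQ'' G q r = (∀ v → 0ℚ ≤ r v) × Constraints G (λ v → b2q (q v)) r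

OptValueQ' : ∀ {n} → SimpleGraph n → ℚ → Set
OptValueQ' {n} G c =
  (Σ (Fin n → Bool) λ q → Σ (Fin n → Bool) λ r →
     FeasibleQ' G q r × objective (λ v → b2q (q v)) (λ v → b2q (r v)) ≡ c)
  × (∀ q r → FeasibleQ' G q r → c ≤ objective (λ v → b2q (q v)) (λ v → b2q (r v)))

OptValueQ'' : ∀ {n} → SimpleGraph n → ℚ → Set
OptValueQ'' {n} G c =
  (Σ (Fin n → Bool) λ q → Σ (Fin n → ℚ) λ r →
     FeasibleQ'' G q r × objective (λ v → b2q (q v)) r ≡ c)
  × (∀ q r → FeasibleQ'' G q r → c ≤ objective (λ v → b2q (q v)) r)

-- Rounding r down, r_v ↦ ⌊r_v⌋, turns every feasible solution of Q'' into one of Q'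
-- with no larger objective. As r_u ≤ q_u ∈ {0,1}, each neighbour u of v contributes
-- ½(q_u + r_u) ∈ {0} ∪ [½, 1] to the covering constraint at v, which rounds to 0, ½
-- or 1; a sum of at least 1 either has a term equal to 1, which is kept, or two
-- positive terms, each still at least ½. So the optimum of Q', which exists because
-- Q' has finitely many solutions and q ≡ 1, r ≡ 0 is one of them, is that of Q''.
module Submission where

open import Defs hiding (sym)
open import Algebra.Bundles using (CommutativeMonoid)
open import Data.Bool using (Bool; true; false; if_then_else_)
open import Data.Empty using (⊥-elim)
open import Data.Fin using (Fin; zero; suc)
open import Data.Fin.Properties using (all?)
open import Data.List using (List; []; _∷_; [_]; cartesianProduct; cartesianProductWith; filter)
open import Data.List.Membership.Propositional using (_∈_)
open import Data.List.Membership.Propositional.Properties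
  using (∈-cartesianProduct⁺; ∈-cartesianProductWith⁺; ∈-filter⁺)
open import Data.List.Relation.Unary.All as All using ()
open import Data.List.Relation.Unary.All.Properties using (all-filter)
open import Data.List.Relation.Unary.Any using (here; there)
open import Data.Nat using (ℕ; zero; suc)
open import Data.Product using (Σ; _×_; _,_; proj₁; proj₂)
open import Data.Rational using (ℚ; 0ℚ; 1ℚ; ½; _+_; _*_; _≤_; _<_; _≤?_)
open import Data.Rational.Properties
open import Data.Unit using (tt)
open import Data.Vec using (Vec; []; _∷_; lookup; tabulate)
open import Data.Vec.Properties using (lookup∘tabulate)
open import Function using (_∘_)
open import Relation.Binary.Bundles using (DecTotalOrder)
open import Relation.Binary.PropositionalEquality
  using (_≡_; refl; sym; trans; cong; cong₂; subst; subst₂; _≗_; module ≡-Reasoning)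
open import Relation.Nullary using (Dec; yes; no; ¬_)
open import Relation.Nullary.Decidable using (_×-dec_)

open import Algebra.Properties.CommutativeSemigroup
  (CommutativeMonoid.commutativeSemigroup +-0-commutativeMonoid) using (interchange)
open import Data.List.Extrema (DecTotalOrder.totalOrder ≤-decTotalOrder)
  using (argmin; argmin-all; f[argmin]≤f[xs])

private
  variable
    n : ℕ

p≤p+q : ∀ p {q} → 0ℚ ≤ q → p ≤ p + q
p≤p+q p 0≤q = subst (_≤ p + _) (+-identityʳ p) (+-monoʳ-≤ p 0≤q)

1≰0 : ¬ (1ℚ ≤ 0ℚ)
1≰0 = ≤⇒≤ᵇ

b2q-nonNeg : ∀ b → 0ℚ ≤ b2q b
b2q-nonNeg true  = ≤ᵇ⇒≤ tt
b2q-nonNeg false = ≤-refl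

sumV-cong : ∀ n {f g : Fin n → ℚ} → f ≗ g → sumV n f ≡ sumV n g
sumV-cong zero    f≗g = refl
sumV-cong (suc n) f≗g = cong₂ _+_ (f≗g zero) (sumV-cong n (f≗g ∘ suc))

sumV-mono : ∀ n {f g : Fin n → ℚ} → (∀ i → f i ≤ g i) → sumV n f ≤ sumV n g
sumV-mono zero    f≤g = ≤-refl
sumV-mono (suc n) f≤g = +-mono-≤ (f≤g zero) (sumV-mono n (f≤g ∘ suc))

sumV-nonNeg : ∀ n {f : Fin n → ℚ} → (∀ i → 0ℚ ≤ f i) → 0ℚ ≤ sumV n f
sumV-nonNeg zero    f≥0 = ≤-refl
sumV-nonNeg (suc n) f≥0 = +-mono-≤ (f≥0 zero) (sumV-nonNeg n (f≥0 ∘ suc))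

sumV-+ : ∀ n (f g : Fin n → ℚ) → sumV n f + sumV n g ≡ sumV n (λ i → f i + g i)
sumV-+ zero    f g = refl
sumV-+ (suc n) f g = trans (interchange (f zero) _ (g zero) _)
                           (cong (f zero + g zero +_) (sumV-+ n (f ∘ suc) (g ∘ suc)))

*-distribˡ-sumV : ∀ n c (f : Fin n → ℚ) → c * sumV n f ≡ sumV n (λ i → c * f i)
*-distribˡ-sumV zero    c f = *-zeroʳ c
*-distribˡ-sumV (suc n) c f = trans (*-distribˡ-+ c (f zero) _)
                                    (cong (c * f zero +_) (*-distribˡ-sumV n c (f ∘ suc)))

neighbourTerm : SimpleGraph n → Fin n → (Fin n → ℚ) → (Fin n → ℚ) → Fin n → ℚ
neighbourTerm G v q r u = if adj G v u then ½ * q u + ½ * r u else 0ℚ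

constraint-lhs : ∀ (G : SimpleGraph n) v q r →
  q v + ½ * sumN G v q + ½ * sumN G v r ≡ q v + sumV n (neighbourTerm G v q r)
constraint-lhs {n} G v q r = begin
  q v + ½ * sumN G v q + ½ * sumN G v r
    ≡⟨ +-assoc (q v) _ _ ⟩
  q v + (½ * sumN G v q + ½ * sumN G v r)
    ≡⟨ cong (q v +_) (cong₂ _+_ (*-distribˡ-sumV n ½ _) (*-distribˡ-sumV n ½ _)) ⟩
  q v + (sumV n (λ u → ½ * gate q u) + sumV n (λ u → ½ * gate r u))
    ≡⟨ cong (q v +_) (trans (sumV-+ n _ _) (sumV-cong n halves-gate)) ⟩
  q v + sumV n (neighbourTerm G v q r) ∎
  where
  open ≡-Reasoning
  gate : (Fin n → ℚ) → Fin n → ℚ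
  gate x u = if adj G v u then x u else 0ℚ
  halves-gate : ∀ u → ½ * gate q u + ½ * gate r u ≡ neighbourTerm G v q r u
  halves-gate u with adj G v u
  ... | true  = refl
  ... | false = refl

sumN-cong : ∀ (G : SimpleGraph n) v {x y : Fin n → ℚ} → x ≗ y → sumN G v x ≡ sumN G v y
sumN-cong {n} G v {x} {y} x≗y = sumV-cong n gated
  where
  gated : ∀ u → (if adj G v u then x u else 0ℚ) ≡ (if adj G v u then y u else 0ℚ)
  gated u with adj G v u
  ... | true  = x≗y u
  ... | false = refl

Constraints-cong : ∀ (G : SimpleGraph n) {q q′ r r′ : Fin n → ℚ} →
  q ≗ q′ → r ≗ r′ → Constraints G q r → Constraints G q′ r′
Constraints-cong G q≗q′ r≗r′ C v =
  subst (1ℚ ≤_) (cong₂ _+_ (cong₂ _+_ (q≗q′ v) (cong (½ *_) (sumN-cong G v q≗q′)))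
                          (cong (½ *_) (sumN-cong G v r≗r′)))
        (proj₁ (C v)) ,
  subst₂ _≤_ (r≗r′ v) (q≗q′ v) (proj₂ (C v))

FeasibleQ'-cong : ∀ (G : SimpleGraph n) {q q′ r r′ : Fin n → Bool} →
  q ≗ q′ → r ≗ r′ → FeasibleQ' G q r → FeasibleQ' G q′ r′
FeasibleQ'-cong G q≗q′ r≗r′ = Constraints-cong G (cong b2q ∘ q≗q′) (cong b2q ∘ r≗r′)

objective-cong : {q q′ r r′ : Fin n → ℚ} →
  q ≗ q′ → r ≗ r′ → objective q r ≡ objective q′ r′
objective-cong {n} q≗q′ r≗r′ =
  cong₂ _+_ (cong ((1ℚ + 1ℚ) *_) (sumV-cong n q≗q′)) (sumV-cong n r≗r′)

Constraints? : ∀ (G : SimpleGraph n) q r → Dec (Constraints G q r)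
Constraints? G q r =
  all? (λ v → (1ℚ ≤? q v + ½ * sumN G v q + ½ * sumN G v r) ×-dec (r v ≤? q v))

bools : List Bool
bools = true ∷ false ∷ []

∈-bools : ∀ b → b ∈ bools
∈-bools true  = here refl
∈-bools false = there (here refl)

allVecs : ∀ k → List (Vec Bool k)
allVecs zero    = [ [] ]
allVecs (suc k) = cartesianProductWith _∷_ bools (allVecs k)

∈-allVecs : ∀ {k} (v : Vec Bool k) → v ∈ allVecs k
∈-allVecs []      = here refl
∈-allVecs (b ∷ v) = ∈-cartesianProductWith⁺ _∷_ (∈-bools b) (∈-allVecs v)

allOnes-feasible : ∀ (G : SimpleGraph n) → FeasibleQ' G (λ _ → true) (λ _ → false)
allOnes-feasible {n} G v =
  subst (1ℚ ≤_) (sym (constraint-lhs G v (λ _ → 1ℚ) (λ _ → 0ℚ)))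
        (p≤p+q 1ℚ (sumV-nonNeg n term≥0)) ,
  ≤ᵇ⇒≤ tt
  where
  term≥0 : ∀ u → 0ℚ ≤ neighbourTerm G v (λ _ → 1ℚ) (λ _ → 0ℚ) u
  term≥0 u with adj G v u
  ... | true  = ≤ᵇ⇒≤ tt
  ... | false = ≤-refl

-- Solutions are encoded as vectors rather than functions so that each one occurs
-- literally in the finite list of candidates.
module Q'Minimum {n} (G : SimpleGraph n) where

  Candidate : Set
  Candidate = Vec Bool n × Vec Bool n

  Feasible : Candidate → Set
  Feasible (q , r) = FeasibleQ' G (lookup q) (lookup r)

  cost : Candidate → ℚ
  cost (q , r) = objective (b2q ∘ lookup q) (b2q ∘ lookup r)

  encode : (Fin n → Bool) → (Fin n → Bool) → Candidate
  encode q r = tabulate q , tabulate r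

  encode-feasible : ∀ {q r} → FeasibleQ' G q r → Feasible (encode q r)
  encode-feasible {q} {r} = FeasibleQ'-cong G (sym ∘ lookup∘tabulate q) (sym ∘ lookup∘tabulate r)

  cost-encode : ∀ q r → cost (encode q r) ≡ objective (b2q ∘ q) (b2q ∘ r)
  cost-encode q r = objective-cong (cong b2q ∘ lookup∘tabulate q) (cong b2q ∘ lookup∘tabulate r)

  feasible? : ∀ c → Dec (Feasible c)
  feasible? (q , r) = Constraints? G (b2q ∘ lookup q) (b2q ∘ lookup r)

  candidates feasibleCandidates : List Candidate
  candidates         = cartesianProduct (allVecs n) (allVecs n)
  feasibleCandidates = filter feasible? candidates

  best : Candidate
  best = argmin cost (encode (λ _ → true) (λ _ → false)) feasibleCandidates

  best-feasible : Feasible best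
  best-feasible = argmin-all cost {xs = feasibleCandidates}
    (encode-feasible (allOnes-feasible G)) (all-filter feasible? candidates)

  best-minimal : ∀ q r → FeasibleQ' G q r → cost best ≤ objective (b2q ∘ q) (b2q ∘ r)
  best-minimal q r feasible = ≤-trans
    (All.lookup (f[argmin]≤f[xs] {f = cost} _ feasibleCandidates)
      (∈-filter⁺ feasible?
        (∈-cartesianProduct⁺ (∈-allVecs (tabulate q)) (∈-allVecs (tabulate r)))
        (encode-feasible feasible)))
    (≤-reflexive (cost-encode q r))

  optimum : OptValueQ' G (cost best)
  optimum = (lookup (proj₁ best) , lookup (proj₂ best) , best-feasible , refl) , best-minimal

Q'-optimum : ∀ (G : SimpleGraph n) → Σ ℚ (OptValueQ' G)
Q'-optimum G = cost best , optimum
  where open Q'Minimum G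

floorBit : ℚ → Bool
floorBit x with 1ℚ ≤? x
... | yes _ = true
... | no  _ = false

floorBit-≤ : ∀ {x} → 0ℚ ≤ x → b2q (floorBit x) ≤ x
floorBit-≤ {x} 0≤x with 1ℚ ≤? x
... | yes 1≤x = 1≤x
... | no  _   = 0≤x

floorBit-≤-b2q : ∀ {x} b → x ≤ b2q b → b2q (floorBit x) ≤ b2q b
floorBit-≤-b2q {x} b x≤b with 1ℚ ≤? x
... | yes 1≤x = ≤-trans 1≤x x≤b
... | no  _   = b2q-nonNeg b

data HalfRounding (t : ℚ) : ℚ → Set where
  drop  : t ≤ 0ℚ → HalfRounding t 0ℚ
  half  : ½ ≤ t → t < 1ℚ → HalfRounding t ½
  whole : HalfRounding t 1ℚ

record SumBounds (S S′ : ℚ) : Set where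
  field
    nonNeg : 0ℚ ≤ S′
    pos⇒½≤ : 0ℚ < S → ½ ≤ S′
    1≤⇒1≤  : 1ℚ ≤ S → 1ℚ ≤ S′

sumBounds-zero : SumBounds 0ℚ 0ℚ
sumBounds-zero = record
  { nonNeg = ≤-refl
  ; pos⇒½≤ = λ 0<0 → ⊥-elim (<-irrefl refl 0<0)
  ; 1≤⇒1≤ = ⊥-elim ∘ 1≰0
  }

sumBounds-+ : ∀ {t t′ S S′} → HalfRounding t t′ → SumBounds S S′ →
  SumBounds (t + S) (t′ + S′)
sumBounds-+ {t} {S = S} {S′} (drop t≤0) B = record
  { nonNeg = subst (0ℚ ≤_) (sym (+-identityˡ S′)) nonNeg
  ; pos⇒½≤ = λ 0<t+S → subst (½ ≤_) (sym (+-identityˡ S′)) (pos⇒½≤ (<-≤-trans 0<t+S t+S≤S))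
  ; 1≤⇒1≤ = λ 1≤t+S → subst (1ℚ ≤_) (sym (+-identityˡ S′)) (1≤⇒1≤ (≤-trans 1≤t+S t+S≤S))
  }
  where
  open SumBounds B
  t+S≤S : t + S ≤ S
  t+S≤S = subst (t + S ≤_) (+-identityˡ S) (+-monoˡ-≤ S t≤0)
sumBounds-+ {t} {S = S} {S′} (half _ t<1) B = record
  { nonNeg = ≤-trans (≤ᵇ⇒≤ tt) (p≤p+q ½ nonNeg)
  ; pos⇒½≤ = λ _ → p≤p+q ½ nonNeg
  ; 1≤⇒1≤ = λ 1≤t+S → +-monoʳ-≤ ½ (pos⇒½≤ (S-pos 1≤t+S))
  }
  where
  open SumBounds B
  S-pos : 1ℚ ≤ t + S → 0ℚ < S
  S-pos 1≤t+S with S ≤? 0ℚ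
  ... | no  S≰0 = ≰⇒> S≰0
  ... | yes S≤0 = ⊥-elim (<-irrefl refl
        (≤-<-trans 1≤t+S (subst (t + S <_) (+-identityʳ 1ℚ) (+-mono-<-≤ t<1 S≤0))))
sumBounds-+ {S′ = S′} whole B = record
  { nonNeg = ≤-trans (≤ᵇ⇒≤ tt) 1≤1+S′
  ; pos⇒½≤ = λ _ → ≤-trans (≤ᵇ⇒≤ tt) 1≤1+S′
  ; 1≤⇒1≤ = λ _ → 1≤1+S′
  }
  where
  1≤1+S′ : 1ℚ ≤ 1ℚ + S′
  1≤1+S′ = p≤p+q 1ℚ (SumBounds.nonNeg B)

sumV-sumBounds : ∀ n {t t′ : Fin n → ℚ} → (∀ i → HalfRounding (t i) (t′ i)) →
  SumBounds (sumV n t) (sumV n t′)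
sumV-sumBounds zero    _ = sumBounds-zero
sumV-sumBounds (suc n) R = sumBounds-+ (R zero) (sumV-sumBounds n (R ∘ suc))

halfSum-halfRounding : ∀ b {x} → 0ℚ ≤ x → x ≤ b2q b →
  HalfRounding (½ * b2q b + ½ * x) (½ * b2q b + ½ * b2q (floorBit x))
halfSum-halfRounding false {x} _ x≤0 with 1ℚ ≤? x
... | yes 1≤x = ⊥-elim (1≰0 (≤-trans 1≤x x≤0))
... | no  _   = drop (+-monoʳ-≤ (½ * 0ℚ) (*-monoˡ-≤-nonNeg ½ x≤0))
halfSum-halfRounding true {x} 0≤x _ with 1ℚ ≤? x
... | yes _   = whole
... | no  1≰x = half (+-monoʳ-≤ (½ * 1ℚ) (*-monoˡ-≤-nonNeg ½ 0≤x))
                     (+-monoʳ-< (½ * 1ℚ) (*-monoʳ-<-pos ½ (≰⇒> 1≰x)))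

1≤bit+sum : ∀ b {S S′} → 1ℚ ≤ b2q b + S → SumBounds S S′ → 1ℚ ≤ b2q b + S′
1≤bit+sum true  _ B = p≤p+q 1ℚ (SumBounds.nonNeg B)
1≤bit+sum false {S} {S′} 1≤S B = subst (1ℚ ≤_) (sym (+-identityˡ S′))
  (SumBounds.1≤⇒1≤ B (subst (1ℚ ≤_) (+-identityˡ S) 1≤S))

floor-feasible : ∀ (G : SimpleGraph n) {q r} →
  FeasibleQ'' G q r → FeasibleQ' G q (floorBit ∘ r)
floor-feasible {n} G {q} {r} (r≥0 , C) v =
  subst (1ℚ ≤_) (sym (constraint-lhs G v (b2q ∘ q) (b2q ∘ floorBit ∘ r)))
    (1≤bit+sum (q v) (subst (1ℚ ≤_) (constraint-lhs G v (b2q ∘ q) r) (proj₁ (C v)))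
                     (sumV-sumBounds n neighbourTerm-halfRounding)) ,
  floorBit-≤-b2q (q v) (proj₂ (C v))
  where
  neighbourTerm-halfRounding : ∀ u →
    HalfRounding (neighbourTerm G v (b2q ∘ q) r u)
                 (neighbourTerm G v (b2q ∘ q) (b2q ∘ floorBit ∘ r) u)
  neighbourTerm-halfRounding u with adj G v u
  ... | true  = halfSum-halfRounding (q u) (r≥0 u) (proj₂ (C u))
  ... | false = drop ≤-refl

floor-objective : ∀ (q : Fin n → ℚ) {r} → (∀ v → 0ℚ ≤ r v) →
  objective q (b2q ∘ floorBit ∘ r) ≤ objective q r
floor-objective {n} q r≥0 = +-monoʳ-≤ ((1ℚ + 1ℚ) * sumV n q) (sumV-mono n (floorBit-≤ ∘ r≥0))

OptValueQ'⇒OptValueQ'' : ∀ (G : SimpleGraph n) {c} → OptValueQ' G c → OptValueQ'' G c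
OptValueQ'⇒OptValueQ'' G ((q , r , feasible , attained) , lower) =
  (q , b2q ∘ r , (b2q-nonNeg ∘ r , feasible) , attained) ,
  λ q′ r′ feasible′ → ≤-trans (lower q′ (floorBit ∘ r′) (floor-feasible G {q′} feasible′))
                              (floor-objective (b2q ∘ q′) (proj₁ feasible′))

theorem7 : (n : ℕ) (G : SimpleGraph n) →
    Σ ℚ λ c → OptValueQ' G c × OptValueQ'' G c
theorem7 n G =
  let c , optimum = Q'-optimum G in c , optimum , OptValueQ'⇒OptValueQ'' G optimum
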